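{- Let $E(X)$ be an equation of the language $\mathcal L_1(M_2)$ whose only possible free variable is $X$ (of sort $\mathsf{list}$), such that $M_2\not\models E(X)$ (i.e. $E$ fails for some value of $X$). Then there exists $N\in\mathbb N$ such that $M_2\not\models E((n)\frown l)$ for all $n\geq N$ and all $l\in\mathfrak L$.
   Context: $\mathcal L_1$ has sorts $\mathsf i$, $\mathsf{list}$ and symbols $\mathit{nil}:\mathsf{list}$, $\mathit{cons}:\mathsf i\times\mathsf{list}\to\mathsf{list}$, infix $\frown:\mathsf{list}\times\mathsf{list}\to\mathsf{list}$. For a structure $M$, $\mathcal L(M)$ extends $\mathcal L$ by a constant for each element of $M$, interpreted by that element. Sequences: $\mathcal X^\alpha$ is the set of functions $\alpha\to\mathcal X$; $\mathbb N^*$ the finite sequences of naturals; $\varepsilon$ the empty sequence, $(n)$ a one-element sequence. For $a\in\mathcal X^\alpha$, $b\in\mathcal X^\beta$, $a\frown b\in\mathcal X^{\alpha+\beta}$ with $(a\frown b)_\gamma=a_\gamma$ for $\gamma<\alpha$ and $(a\frown b)_{\alpha+\delta}=b_\delta$. For $\alpha>0$ and $\mathfrak a\in(\mathcal X^\alpha)^\beta$, $\lfloor\mathfrak a\rfloor\in\mathcal X^{\alpha\cdot\beta}$ with $\lfloor\mathfrak a\rfloor_{\alpha\cdot\delta+\mu}=(\mathfrak a_\delta)_\mu$ for $\mu<\alpha$. $N_k=(i)_{k\le i<\omega}$, $\mathcal N=\{w\frown N_k: w\in\mathbb N^*,k\in\mathbb N\}$. The structure $M_2$ interprets $\mathsf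 i$ as $\mathbb N$, $\mathsf{list}$ as $\mathfrak L=\{\lfloor\mathfrak l\rfloor\frown w: w\in\mathbb N^*, \mathfrak l\in\mathcal N^\beta,\beta<\omega^2\}$, $\mathit{nil}$ as $\varepsilon$, $\mathit{cons}(n,l)$ as $(n)\frown l$, and $\frown$ as concatenation. -}

module Defs where

open import Data.Nat using (ℕ; zero; suc; _+_; _∸_; _<_; _≤_; _<ᵇ_; _≡ᵇ_)
open import Data.Bool using (Bool; true; false; if_then_else_; _∧_; _∨_; T)
open import Data.List using (List; []; _∷_; length)
open import Data.Product using (Σ; ∃; _×_; _,_; proj₁)
open import Relation.Binary.PropositionalEquality using (_≡_)

-- Ordinals below ω³ in Cantor normal form: (a , b , c) = ω²·a + ω·b + c.
-- Every element of 𝔏 (and every concatenation of such) has length < ω³.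

Ord : Set
Ord = ℕ × ℕ × ℕ

_<ᵒᵇ_ : Ord → Ord → Bool
(a , b , c) <ᵒᵇ (a' , b' , c') =
  (a <ᵇ a') ∨ ((a ≡ᵇ a') ∧ ((b <ᵇ b') ∨ ((b ≡ᵇ b') ∧ (c <ᵇ c'))))

_<ᵒ_ : Ord → Ord → Set
α <ᵒ β = T (α <ᵒᵇ β)

_+ᵒ_ : Ord → Ord → Ord
(a , b , c) +ᵒ (suc a' , b' , c') = (a + suc a' , b' , c')
(a , b , c) +ᵒ (zero , suc b' , c') = (a , b + suc b' , c')
(a , b , c) +ᵒ (zero , zero , c') = (a , b , c + c')

-- for α ≤ γ, γ ∸ᵒ α is the unique δ with α + δ = γ
_∸ᵒ_ : Ord → Ord → Ord
(x , y , z) ∸ᵒ (a , b , c) =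
  if a <ᵇ x then (x ∸ a , y , z)
  else if b <ᵇ y then (0 , y ∸ b , z)
  else (0 , 0 , z ∸ c)

-- Transfinite sequences of naturals of length < ω³: a length together
-- with the values (only the values at positions < len matter).

record Seq : Set where
  constructor mkSeq
  field
    len : Ord
    at  : Ord → ℕ
open Seq public

_≈_ : Seq → Seq → Set
s ≈ t = (len s ≡ len t) × (∀ γ → γ <ᵒ len s → at s γ ≡ at t γ)

_⁀_ : Seq → Seq → Seq
s ⁀ t = mkSeq (len s +ᵒ len t)
              (λ γ → if γ <ᵒᵇ len s then at s γ else at t (γ ∸ᵒ len s))

ε : Seq
ε = mkSeq (0 , 0 , 0) (λ _ → 0)

⟨_⟩ : ℕ → Seq
⟨ n ⟩ = mkSeq (0 , 0 , 1) (λ _ → n)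

-- ω-sequences (length ω) are functions ℕ → ℕ; finite prefix w ⁀ f
_⁀ω_ : List ℕ → (ℕ → ℕ) → (ℕ → ℕ)
([] ⁀ω f) i = f i
((x ∷ w) ⁀ω f) zero = x
((x ∷ w) ⁀ω f) (suc i) = (w ⁀ω f) i

fin : List ℕ → Seq
fin w = mkSeq (0 , 0 , length w) (λ { (_ , _ , z) → (w ⁀ω (λ _ → 0)) z })

Nω : ℕ → (ℕ → ℕ)
Nω k j = k + j

In𝒩 : (ℕ → ℕ) → Set
In𝒩 f = Σ (List ℕ) λ w → Σ ℕ λ k → ∀ i → f i ≡ (w ⁀ω Nω k) i

-- ⌊𝔩⌋ for 𝔩 ∈ (𝒳^ω)^β with β = ω·p + q < ω²; 𝔩 x y is the entry at δ = ω·x + y.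
-- ⌊𝔩⌋ has length ω·β = ω²·p + ω·q and ⌊𝔩⌋_(ω·δ+μ) = (𝔩_δ)_μ.
⌊_⌋ω : (Σ ℕ λ p → Σ ℕ λ q → (ℕ → ℕ → ℕ → ℕ)) → Seq
⌊ (p , q , 𝔩) ⌋ω = mkSeq (p , q , 0) (λ { (x , y , z) → 𝔩 x y z })

In𝔏 : Seq → Set
In𝔏 s =
  Σ ℕ λ p → Σ ℕ λ q → Σ (ℕ → ℕ → ℕ → ℕ) λ 𝔩 →
    (∀ x y → (x , y , 0) <ᵒ (p , q , 0) → In𝒩 (𝔩 x y)) ×
    (Σ (List ℕ) λ w → s ≈ (⌊ (p , q , 𝔩) ⌋ω ⁀ fin w))

𝔏 : Set
𝔏 = Σ Seq In𝔏

data Sort : Set where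
  i list : Sort

data Term : Sort → Set where
  X     : Term list
  cᵢ    : ℕ → Term i
  cₗ    : 𝔏 → Term list
  nil   : Term list
  cons  : Term i → Term list → Term list
  _⁀ₜ_  : Term list → Term list → Term list

⟦_⟧ₛ : Sort → Set
⟦ i ⟧ₛ = ℕ
⟦ list ⟧ₛ = Seq

⟦_⟧ : ∀ {s} → Term s → Seq → ⟦ s ⟧ₛ
⟦ X ⟧ v = v
⟦ cᵢ n ⟧ v = n
⟦ cₗ l ⟧ v = proj₁ l
⟦ nil ⟧ v = ε
⟦ cons t u ⟧ v = ⟨ ⟦ t ⟧ v ⟩ ⁀ ⟦ u ⟧ v
⟦ t ⁀ₜ u ⟧ v = ⟦ t ⟧ v ⁀ ⟦ u ⟧ v

record Equation : Set where
  constructor _≐_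
  field
    {sort} : Sort
    lhs rhs : Term sort

EqAt : (s : Sort) → ⟦ s ⟧ₛ → ⟦ s ⟧ₛ → Set
EqAt i m n = m ≡ n
EqAt list u v = u ≈ v

Holds : Equation → Seq → Set
Holds (t ≐ u) v = EqAt _ (⟦ t ⟧ v) (⟦ u ⟧ v)

module Submission where

-- Every list term normalises to a word c₀ X c₁ X ⋯ X cₖ with constant
-- sequences cⱼ.  Evaluated at X = (n) ⁀ l, the entry of such a word at
-- position len c₀ is n.  So if two words have different shapes, or their
-- first X sit at different positions, the equation pins n to an entry of a
-- constant and fails once n exceeds it.  Otherwise the equation cancels to
-- c₀ = d₀ and to the equation between the remaining words, and induction
-- applies: for all large n, an equation holding at some (n) ⁀ l holds
-- everywhere.

open import Defs
open import Data.Nat using (ℕ; _≤_)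
open import Data.Product using (Σ; proj₁)
open import Relation.Nullary using (¬_)

open import Data.Nat using (zero; suc; _+_; _<_; _<ᵇ_; _≡ᵇ_; z<s)
open import Data.Nat.Properties
  using ( <-irrefl; <-isStrictTotalOrder; +-identityʳ; +-assoc; +-suc
        ; +-monoʳ-<; m<m+n; m+n∸m≡n; <ᵇ-reflects-<; ≡ᵇ⇒≡; ≡⇒≡ᵇ; m≤n⇒∃[o]m+o≡n)
open import Data.Bool using (true; false)
open import Data.Product using (∃; _×_; _,_)
open import Data.Product.Relation.Binary.Lex.Strict using (×-Lex; ×-isStrictTotalOrder)
open import Data.Product.Relation.Binary.Pointwise.NonDependent using (≡×≡⇒≡)
open import Data.Sum using (_⊎_; inj₁; inj₂)
open import Data.Unit using (tt)
open import Function using (_∘_; _⇔_; mk⇔; Equivalence)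
import Relation.Binary.Reasoning.Setoid as SetoidReasoning
open import Level using (0ℓ)
open import Relation.Binary.Bundles using (Setoid)
open import Relation.Binary.Core using (Rel)
open import Relation.Binary.Definitions
  using (Trichotomous; Transitive; tri<; tri≈; tri>)
open import Relation.Binary.Structures using (IsEquivalence; IsStrictTotalOrder)
open import Relation.Binary.Consequences using (tri⇒irr; tri⇒asym)
open import Relation.Binary.PropositionalEquality
  using (_≡_; refl; sym; trans; cong; cong₂; subst; module ≡-Reasoning)
open import Relation.Nullary.Negation using (contradiction)
open import Relation.Nullary.Reflects
  using (Reflects; ofʸ; ofⁿ; fromEquivalence; _⊎-reflects_; _×-reflects_)

strictMono⇒reflects : ∀ {a b ℓ₁ ℓ₂} {A : Set a} {B : Set b}
  {_<₁_ : Rel A ℓ₁} {_<₂_ : Rel B ℓ₂} →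
  Trichotomous _≡_ _<₁_ → Trichotomous _≡_ _<₂_ →
  (f : A → B) → (∀ {x y} → x <₁ y → f x <₂ f y) →
  ∀ {x y} → f x <₂ f y → x <₁ y
strictMono⇒reflects cmp₁ cmp₂ f mono {x} {y} fx<fy with cmp₁ x y
... | tri< x<y _ _ = x<y
... | tri≈ _ refl _ = contradiction fx<fy (tri⇒irr cmp₂ refl)
... | tri> _ _ y<x = contradiction fx<fy (tri⇒asym cmp₂ (mono y<x))

infix 4 _≺_

_≺_ : Rel Ord 0ℓ
_≺_ = ×-Lex _≡_ _<_ (×-Lex _≡_ _<_ _<_)

≡ᵇ-reflects-≡ : ∀ m n → Reflects (m ≡ n) (m ≡ᵇ n)
≡ᵇ-reflects-≡ m n = fromEquivalence (≡ᵇ⇒≡ m n) (≡⇒≡ᵇ m n)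

<ᵒᵇ-reflects-≺ : ∀ α β → Reflects (α ≺ β) (α <ᵒᵇ β)
<ᵒᵇ-reflects-≺ (a , b , c) (a' , b' , c') =
  <ᵇ-reflects-< a a' ⊎-reflects ≡ᵇ-reflects-≡ a a' ×-reflects
    (<ᵇ-reflects-< b b' ⊎-reflects ≡ᵇ-reflects-≡ b b' ×-reflects <ᵇ-reflects-< c c')

<ᵒ⇒≺ : ∀ {α β} → α <ᵒ β → α ≺ β
<ᵒ⇒≺ {α} {β} α<β with α <ᵒᵇ β | <ᵒᵇ-reflects-≺ α β
... | true | ofʸ α≺β = α≺β

≺⇒<ᵒ : ∀ {α β} → α ≺ β → α <ᵒ β
≺⇒<ᵒ {α} {β} α≺β with α <ᵒᵇ β | <ᵒᵇ-reflects-≺ α β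
... | true  | _       = tt
... | false | ofⁿ α⊀β = α⊀β α≺β

private
  module Lex = IsStrictTotalOrder
    (×-isStrictTotalOrder <-isStrictTotalOrder
      (×-isStrictTotalOrder <-isStrictTotalOrder <-isStrictTotalOrder))

≺-trans : Transitive _≺_
≺-trans = Lex.trans

≺-cmp : Trichotomous _≡_ _≺_
≺-cmp α β with Lex.compare α β
... | tri< α≺β α≉β β⊀α = tri< α≺β (α≉β ∘ Lex.Eq.reflexive) β⊀α
... | tri≈ α⊀β (p , q) β⊀α = tri≈ α⊀β (≡×≡⇒≡ (p , ≡×≡⇒≡ q)) β⊀α
... | tri> α⊀β α≉β β≺α = tri> α⊀β (α≉β ∘ Lex.Eq.reflexive) β≺α

0ᵒ : Ord
0ᵒ = 0 , 0 , 0

α⊀0 : ∀ {α} → ¬ α ≺ 0ᵒ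
α⊀0 (inj₁ ())
α⊀0 (inj₂ (_ , inj₁ ()))
α⊀0 (inj₂ (_ , inj₂ (_ , ())))

+ᵒ-identityˡ : ∀ α → 0ᵒ +ᵒ α ≡ α
+ᵒ-identityˡ (suc a , b , c) = refl
+ᵒ-identityˡ (zero , suc b , c) = refl
+ᵒ-identityˡ (zero , zero , c) = refl

+ᵒ-identityʳ : ∀ α → α +ᵒ 0ᵒ ≡ α
+ᵒ-identityʳ (a , b , c) = cong (λ z → a , b , z) (+-identityʳ c)

+ᵒ-assoc : ∀ α β γ → (α +ᵒ β) +ᵒ γ ≡ α +ᵒ (β +ᵒ γ)
+ᵒ-assoc (a , _ , _) (suc p , _ , _) (suc g , h , k) = cong (λ z → z , h , k) (+-assoc a (suc p) (suc g))
+ᵒ-assoc _ (suc _ , _ , _) (zero , suc _ , _) = refl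
+ᵒ-assoc _ (suc _ , _ , _) (zero , zero , _) = refl
+ᵒ-assoc _ (zero , suc _ , _) (suc _ , _ , _) = refl
+ᵒ-assoc (a , b , _) (zero , suc q , _) (zero , suc h , k) = cong (λ z → a , z , k) (+-assoc b (suc q) (suc h))
+ᵒ-assoc _ (zero , suc _ , _) (zero , zero , _) = refl
+ᵒ-assoc _ (zero , zero , _) (suc _ , _ , _) = refl
+ᵒ-assoc _ (zero , zero , _) (zero , suc _ , _) = refl
+ᵒ-assoc (a , b , c) (zero , zero , r) (zero , zero , k) = cong (λ z → a , b , z) (+-assoc c r k)

+ᵒ-monoʳ-≺ : ∀ α {β γ} → β ≺ γ → α +ᵒ β ≺ α +ᵒ γ
+ᵒ-monoʳ-≺ (a , _ , _) {suc _ , _ , _} {suc _ , _ , _} (inj₁ p) = inj₁ (+-monoʳ-< a p)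
+ᵒ-monoʳ-≺ _ {suc _ , _ , _} {suc _ , _ , _} (inj₂ (refl , q)) = inj₂ (refl , q)
+ᵒ-monoʳ-≺ _ {suc _ , _ , _} {zero , _ , _} (inj₁ ())
+ᵒ-monoʳ-≺ (a , _ , _) {zero , suc _ , _} {suc _ , _ , _} _ = inj₁ (m<m+n a z<s)
+ᵒ-monoʳ-≺ (a , _ , _) {zero , zero , _} {suc _ , _ , _} _ = inj₁ (m<m+n a z<s)
+ᵒ-monoʳ-≺ (_ , b , _) {zero , suc _ , _} {zero , suc _ , _} (inj₂ (refl , inj₁ p)) = inj₂ (refl , inj₁ (+-monoʳ-< b p))
+ᵒ-monoʳ-≺ _ {zero , suc _ , _} {zero , suc _ , _} (inj₂ (refl , inj₂ (refl , p))) = inj₂ (refl , inj₂ (refl , p))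
+ᵒ-monoʳ-≺ _ {zero , suc _ , _} {zero , zero , _} (inj₂ (refl , inj₁ ()))
+ᵒ-monoʳ-≺ (_ , b , _) {zero , zero , _} {zero , suc _ , _} _ = inj₂ (refl , inj₁ (m<m+n b z<s))
+ᵒ-monoʳ-≺ _ {zero , zero , _} {zero , zero , _} (inj₂ (refl , inj₁ ()))
+ᵒ-monoʳ-≺ (_ , _ , c) {zero , zero , _} {zero , zero , _} (inj₂ (refl , inj₂ (refl , p))) = inj₂ (refl , inj₂ (refl , +-monoʳ-< c p))

+ᵒ-cancelˡ-≺ : ∀ α {β γ} → α +ᵒ β ≺ α +ᵒ γ → β ≺ γ
+ᵒ-cancelˡ-≺ α = strictMono⇒reflects ≺-cmp ≺-cmp (α +ᵒ_) (+ᵒ-monoʳ-≺ α)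

α+β⊀α : ∀ α β → ¬ α +ᵒ β ≺ α
α+β⊀α α β α+β≺α = α⊀0 (+ᵒ-cancelˡ-≺ α {β} {0ᵒ} (subst (α +ᵒ β ≺_) (sym (+ᵒ-identityʳ α)) α+β≺α))

α≺α+β : ∀ α β → 0ᵒ ≺ β → α ≺ α +ᵒ β
α≺α+β α β 0≺β = subst (_≺ α +ᵒ β) (+ᵒ-identityʳ α) (+ᵒ-monoʳ-≺ α 0≺β)

≺α⇒≺α+β : ∀ α β {γ} → γ ≺ α → γ ≺ α +ᵒ β
≺α⇒≺α+β α β γ≺α with ≺-cmp 0ᵒ β
... | tri< 0≺β _ _ = ≺-trans γ≺α (α≺α+β α β 0≺β)
... | tri≈ _ refl _ = subst (_ ≺_) (sym (+ᵒ-identityʳ α)) γ≺α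
... | tri> _ _ β≺0 = contradiction β≺0 α⊀0

n<ᵇn≡false : ∀ n → (n <ᵇ n) ≡ false
n<ᵇn≡false zero = refl
n<ᵇn≡false (suc n) = n<ᵇn≡false n

m<ᵇm+1+n≡true : ∀ m n → (m <ᵇ m + suc n) ≡ true
m<ᵇm+1+n≡true zero n = refl
m<ᵇm+1+n≡true (suc m) n = m<ᵇm+1+n≡true m n

α+β∸α≡β : ∀ α β → (α +ᵒ β) ∸ᵒ α ≡ β
α+β∸α≡β (a , _ , _) (suc k , _ , _)
  rewrite m<ᵇm+1+n≡true a k | m+n∸m≡n a (suc k) = refl
α+β∸α≡β (a , b , _) (zero , suc k , _)
  rewrite n<ᵇn≡false a | m<ᵇm+1+n≡true b k | m+n∸m≡n b (suc k) = refl
α+β∸α≡β (a , b , c) (zero , zero , z)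
  rewrite n<ᵇn≡false a | n<ᵇn≡false b | m+n∸m≡n c z = refl

+ᵒ-cancelˡ-≡ : ∀ α {β γ} → α +ᵒ β ≡ α +ᵒ γ → β ≡ γ
+ᵒ-cancelˡ-≡ α {β} {γ} eq =
  trans (sym (α+β∸α≡β α β)) (trans (cong (_∸ᵒ α) eq) (α+β∸α≡β α γ))

≺⇒∃+ᵒ : ∀ {α γ} → α ≺ γ → ∃ λ δ → γ ≡ α +ᵒ δ
≺⇒∃+ᵒ {a , _ , _} {_ , y , z} (inj₁ p) with k , refl ← m≤n⇒∃[o]m+o≡n p =
  (suc k , y , z) , cong (λ x → x , y , z) (sym (+-suc a k))
≺⇒∃+ᵒ {a , b , _} {_ , _ , z} (inj₂ (refl , inj₁ p)) with k , refl ← m≤n⇒∃[o]m+o≡n p =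
  (0 , suc k , z) , cong (λ x → a , x , z) (sym (+-suc b k))
≺⇒∃+ᵒ {a , b , c} (inj₂ (refl , inj₂ (refl , p))) with k , refl ← m≤n⇒∃[o]m+o≡n p =
  (0 , 0 , suc k) , cong (λ x → a , b , x) (sym (+-suc c k))

≺-+ᵒ-split : ∀ α β {γ} → γ ≺ α +ᵒ β →
  γ ≺ α ⊎ ∃ λ δ → γ ≡ α +ᵒ δ × δ ≺ β
≺-+ᵒ-split α β {γ} γ≺α+β with ≺-cmp γ α
... | tri< γ≺α _ _ = inj₁ γ≺α
... | tri≈ _ refl _ =
  inj₂ (0ᵒ , sym (+ᵒ-identityʳ γ) ,
        +ᵒ-cancelˡ-≺ γ (subst (_≺ γ +ᵒ β) (sym (+ᵒ-identityʳ γ)) γ≺α+β))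
... | tri> _ _ α≺γ with δ , refl ← ≺⇒∃+ᵒ α≺γ = inj₂ (δ , refl , +ᵒ-cancelˡ-≺ α γ≺α+β)

≈-isEquivalence : IsEquivalence _≈_
≈-isEquivalence = record
  { refl  = refl , λ _ _ → refl
  ; sym   = λ { (e , f) → sym e , λ γ γ<t → sym (f γ (subst (γ <ᵒ_) (sym e) γ<t)) }
  ; trans = λ { (e , f) (e' , g) → trans e e' , λ γ γ<s → trans (f γ γ<s) (g γ (subst (γ <ᵒ_) e γ<s)) }
  }

Seq-setoid : Setoid 0ℓ 0ℓ
Seq-setoid = record { isEquivalence = ≈-isEquivalence }

open Setoid Seq-setoid using () renaming (refl to ≈-refl; sym to ≈-sym; trans to ≈-trans)

≈⇒at≡ : ∀ {s t} → s ≈ t → ∀ {γ} → γ ≺ len s → at s γ ≡ at t γ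
≈⇒at≡ (_ , f) γ≺s = f _ (≺⇒<ᵒ γ≺s)

at-⁀ˡ : ∀ s t {γ} → γ ≺ len s → at (s ⁀ t) γ ≡ at s γ
at-⁀ˡ s t {γ} γ≺s with γ <ᵒᵇ len s | <ᵒᵇ-reflects-≺ γ (len s)
... | true  | _       = refl
... | false | ofⁿ γ⊀s = contradiction γ≺s γ⊀s

at-⁀ʳ : ∀ s t δ → at (s ⁀ t) (len s +ᵒ δ) ≡ at t δ
at-⁀ʳ s t δ with (len s +ᵒ δ) <ᵒᵇ len s | <ᵒᵇ-reflects-≺ (len s +ᵒ δ) (len s)
... | true  | ofʸ wraps = contradiction wraps (α+β⊀α (len s) δ)
... | false | _         = cong (at t) (α+β∸α≡β (len s) δ)

⁀-cong : ∀ {s s' t t'} → s ≈ s' → t ≈ t' → (s ⁀ t) ≈ (s' ⁀ t')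
⁀-cong {s} {s'} {t} {t'} s≈s'@(e , _) t≈t' = cong₂ _+ᵒ_ e (proj₁ t≈t') , λ γ γ< → pointwise (<ᵒ⇒≺ γ<)
  where
  pointwise : ∀ {γ} → γ ≺ len s +ᵒ len t → at (s ⁀ t) γ ≡ at (s' ⁀ t') γ
  pointwise {γ} γ≺ with ≺-+ᵒ-split (len s) (len t) γ≺
  ... | inj₁ γ≺s = begin
    at (s ⁀ t) γ   ≡⟨ at-⁀ˡ s t γ≺s ⟩
    at s γ         ≡⟨ ≈⇒at≡ s≈s' γ≺s ⟩
    at s' γ        ≡⟨ at-⁀ˡ s' t' (subst (γ ≺_) e γ≺s) ⟨
    at (s' ⁀ t') γ ∎
    where open ≡-Reasoning
  ... | inj₂ (δ , refl , δ≺t) = begin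
    at (s ⁀ t) (len s +ᵒ δ)    ≡⟨ at-⁀ʳ s t δ ⟩
    at t δ                     ≡⟨ ≈⇒at≡ t≈t' δ≺t ⟩
    at t' δ                    ≡⟨ at-⁀ʳ s' t' δ ⟨
    at (s' ⁀ t') (len s' +ᵒ δ) ≡⟨ cong (λ α → at (s' ⁀ t') (α +ᵒ δ)) e ⟨
    at (s' ⁀ t') (len s +ᵒ δ)  ∎
    where open ≡-Reasoning

⁀-assoc : ∀ s t u → ((s ⁀ t) ⁀ u) ≈ (s ⁀ (t ⁀ u))
⁀-assoc s t u = +ᵒ-assoc (len s) (len t) (len u) , λ γ γ< → pointwise (<ᵒ⇒≺ γ<)
  where
  open ≡-Reasoning
  pointwise : ∀ {γ} → γ ≺ (len s +ᵒ len t) +ᵒ len u → at ((s ⁀ t) ⁀ u) γ ≡ at (s ⁀ (t ⁀ u)) γ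
  pointwise {γ} γ≺ with ≺-+ᵒ-split (len s +ᵒ len t) (len u) γ≺
  ... | inj₂ (δ , refl , _) = begin
    at ((s ⁀ t) ⁀ u) ((len s +ᵒ len t) +ᵒ δ) ≡⟨ at-⁀ʳ (s ⁀ t) u δ ⟩
    at u δ                                   ≡⟨ at-⁀ʳ t u δ ⟨
    at (t ⁀ u) (len t +ᵒ δ)                  ≡⟨ at-⁀ʳ s (t ⁀ u) (len t +ᵒ δ) ⟨
    at (s ⁀ (t ⁀ u)) (len s +ᵒ (len t +ᵒ δ)) ≡⟨ cong (at (s ⁀ (t ⁀ u))) (+ᵒ-assoc (len s) (len t) δ) ⟨
    at (s ⁀ (t ⁀ u)) ((len s +ᵒ len t) +ᵒ δ) ∎
  ... | inj₁ γ≺st with ≺-+ᵒ-split (len s) (len t) γ≺st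
  ...   | inj₁ γ≺s = begin
    at ((s ⁀ t) ⁀ u) γ ≡⟨ at-⁀ˡ (s ⁀ t) u γ≺st ⟩
    at (s ⁀ t) γ       ≡⟨ at-⁀ˡ s t γ≺s ⟩
    at s γ             ≡⟨ at-⁀ˡ s (t ⁀ u) γ≺s ⟨
    at (s ⁀ (t ⁀ u)) γ ∎
  ...   | inj₂ (δ , refl , δ≺t) = begin
    at ((s ⁀ t) ⁀ u) (len s +ᵒ δ) ≡⟨ at-⁀ˡ (s ⁀ t) u γ≺st ⟩
    at (s ⁀ t) (len s +ᵒ δ)       ≡⟨ at-⁀ʳ s t δ ⟩
    at t δ                        ≡⟨ at-⁀ˡ t u δ≺t ⟨
    at (t ⁀ u) δ                  ≡⟨ at-⁀ʳ s (t ⁀ u) δ ⟨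
    at (s ⁀ (t ⁀ u)) (len s +ᵒ δ) ∎

⁀-identityˡ : ∀ s → (ε ⁀ s) ≈ s
⁀-identityˡ s = +ᵒ-identityˡ (len s) , λ γ γ< → pointwise (<ᵒ⇒≺ γ<)
  where
  pointwise : ∀ {γ} → γ ≺ 0ᵒ +ᵒ len s → at (ε ⁀ s) γ ≡ at s γ
  pointwise γ≺ with ≺-+ᵒ-split 0ᵒ (len s) γ≺
  ... | inj₁ γ≺0 = contradiction γ≺0 α⊀0
  ... | inj₂ (δ , refl , _) = trans (at-⁀ʳ ε s δ) (cong (at s) (sym (+ᵒ-identityˡ δ)))

⁀-identityʳ : ∀ s → (s ⁀ ε) ≈ s
⁀-identityʳ s = +ᵒ-identityʳ (len s) , λ γ γ< → pointwise (<ᵒ⇒≺ γ<)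
  where
  pointwise : ∀ {γ} → γ ≺ len s +ᵒ 0ᵒ → at (s ⁀ ε) γ ≡ at s γ
  pointwise γ≺ with ≺-+ᵒ-split (len s) 0ᵒ γ≺
  ... | inj₁ γ≺s = at-⁀ˡ s ε γ≺s
  ... | inj₂ (_ , _ , δ≺0) = contradiction δ≺0 α⊀0

⁀-injective : ∀ s s' t t' → len s ≡ len s' → (s ⁀ t) ≈ (s' ⁀ t') → s ≈ s' × t ≈ t'
⁀-injective s s' t t' e st≈s't' =
  (e , λ γ γ< → prefix (<ᵒ⇒≺ γ<)) ,
  (+ᵒ-cancelˡ-≡ (len s) (trans (proj₁ st≈s't') (cong (_+ᵒ len t') (sym e))) ,
   λ δ δ< → suffix (<ᵒ⇒≺ δ<))
  where
  open ≡-Reasoning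
  prefix : ∀ {γ} → γ ≺ len s → at s γ ≡ at s' γ
  prefix {γ} γ≺s = begin
    at s γ         ≡⟨ at-⁀ˡ s t γ≺s ⟨
    at (s ⁀ t) γ   ≡⟨ ≈⇒at≡ st≈s't' (≺α⇒≺α+β (len s) (len t) γ≺s) ⟩
    at (s' ⁀ t') γ ≡⟨ at-⁀ˡ s' t' (subst (γ ≺_) e γ≺s) ⟩
    at s' γ        ∎
  suffix : ∀ {δ} → δ ≺ len t → at t δ ≡ at t' δ
  suffix {δ} δ≺t = begin
    at t δ                     ≡⟨ at-⁀ʳ s t δ ⟨
    at (s ⁀ t) (len s +ᵒ δ)    ≡⟨ ≈⇒at≡ st≈s't' (+ᵒ-monoʳ-≺ (len s) δ≺t) ⟩
    at (s' ⁀ t') (len s +ᵒ δ)  ≡⟨ cong (λ α → at (s' ⁀ t') (α +ᵒ δ)) e ⟩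
    at (s' ⁀ t') (len s' +ᵒ δ) ≡⟨ at-⁀ʳ s' t' δ ⟩
    at t' δ                    ∎

0≺len-⟨n⟩⁀ : ∀ n s → 0ᵒ ≺ len (⟨ n ⟩ ⁀ s)
0≺len-⟨n⟩⁀ n s = ≺α⇒≺α+β (len ⟨ n ⟩) (len s) (inj₂ (refl , inj₂ (refl , z<s)))

at-⟨n⟩⁀ : ∀ n s → at (⟨ n ⟩ ⁀ s) 0ᵒ ≡ n
at-⟨n⟩⁀ n s = at-⁀ˡ ⟨ n ⟩ s (inj₂ (refl , inj₂ (refl , z<s)))

at-len-⁀ : ∀ s t → at (s ⁀ t) (len s) ≡ at t 0ᵒ
at-len-⁀ s t = subst (λ α → at (s ⁀ t) α ≡ at t 0ᵒ) (+ᵒ-identityʳ (len s)) (at-⁀ʳ s t 0ᵒ)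

infixr 5 _·X·_

data Word : Set where
  const : Seq → Word
  _·X·_ : Seq → Word → Word

⟦_⟧ʷ : Word → Seq → Seq
⟦ const c ⟧ʷ v = c
⟦ c ·X· w ⟧ʷ v = c ⁀ (v ⁀ ⟦ w ⟧ʷ v)

_◃_ : Seq → Word → Word
s ◃ const c = const (s ⁀ c)
s ◃ (c ·X· w) = (s ⁀ c) ·X· w

_++ʷ_ : Word → Word → Word
const c ++ʷ w' = c ◃ w'
(c ·X· w) ++ʷ w' = c ·X· (w ++ʷ w')

⟦◃⟧ : ∀ s w v → ⟦ s ◃ w ⟧ʷ v ≈ (s ⁀ ⟦ w ⟧ʷ v)
⟦◃⟧ s (const c) v = ≈-refl
⟦◃⟧ s (c ·X· w) v = ⁀-assoc s c (v ⁀ ⟦ w ⟧ʷ v)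

⟦++ʷ⟧ : ∀ w w' v → ⟦ w ++ʷ w' ⟧ʷ v ≈ (⟦ w ⟧ʷ v ⁀ ⟦ w' ⟧ʷ v)
⟦++ʷ⟧ (const c) w' v = ⟦◃⟧ c w' v
⟦++ʷ⟧ (c ·X· w) w' v = begin
  c ⁀ (v ⁀ ⟦ w ++ʷ w' ⟧ʷ v)           ≈⟨ ⁀-cong (≈-refl {c}) (⁀-cong (≈-refl {v}) (⟦++ʷ⟧ w w' v)) ⟩
  c ⁀ (v ⁀ (⟦ w ⟧ʷ v ⁀ ⟦ w' ⟧ʷ v))     ≈⟨ ⁀-cong (≈-refl {c}) (⁀-assoc v (⟦ w ⟧ʷ v) (⟦ w' ⟧ʷ v)) ⟨
  c ⁀ ((v ⁀ ⟦ w ⟧ʷ v) ⁀ ⟦ w' ⟧ʷ v)     ≈⟨ ⁀-assoc c (v ⁀ ⟦ w ⟧ʷ v) (⟦ w' ⟧ʷ v) ⟨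
  (c ⁀ (v ⁀ ⟦ w ⟧ʷ v)) ⁀ ⟦ w' ⟧ʷ v     ∎
  where open SetoidReasoning Seq-setoid

word : Term list → Word
word X = ε ·X· const ε
word (cₗ l) = const (proj₁ l)
word nil = const ε
word (cons (cᵢ m) u) = ⟨ m ⟩ ◃ word u
word (t ⁀ₜ u) = word t ++ʷ word u

⟦word⟧ : ∀ t v → ⟦ t ⟧ v ≈ ⟦ word t ⟧ʷ v
⟦word⟧ X v = ≈-sym (≈-trans (⁀-identityˡ (v ⁀ ε)) (⁀-identityʳ v))
⟦word⟧ (cₗ l) v = ≈-refl
⟦word⟧ nil v = ≈-refl
⟦word⟧ (cons (cᵢ m) u) v = ≈-trans (⁀-cong ≈-refl (⟦word⟧ u v)) (≈-sym (⟦◃⟧ ⟨ m ⟩ (word u) v))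
⟦word⟧ (t ⁀ₜ u) v = ≈-trans (⁀-cong (⟦word⟧ t v) (⟦word⟧ u v)) (≈-sym (⟦++ʷ⟧ (word t) (word u) v))

word-equation : ∀ t u v → (⟦ t ⟧ v ≈ ⟦ u ⟧ v) ⇔ (⟦ word t ⟧ʷ v ≈ ⟦ word u ⟧ʷ v)
word-equation t u v = mk⇔
  (λ t≈u → ≈-trans (≈-sym (⟦word⟧ t v)) (≈-trans t≈u (⟦word⟧ u v)))
  (λ t≈u → ≈-trans (⟦word⟧ t v) (≈-trans t≈u (≈-sym (⟦word⟧ u v))))

X-pinned : ∀ c r (s : Seq → Seq) {m} → (∀ v → at (s v) (len c) ≡ m) →
  ∀ {n} → m < n → ∀ l → ¬ ⟦ c ·X· r ⟧ʷ (⟨ n ⟩ ⁀ l) ≈ s (⟨ n ⟩ ⁀ l)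
X-pinned c r s {m} pinned {n} m<n l eq = <-irrefl (sym n≡m) m<n
  where
  open ≡-Reasoning
  v = ⟨ n ⟩ ⁀ l
  u = v ⁀ ⟦ r ⟧ʷ v
  c≺c⁀u : len c ≺ len (c ⁀ u)
  c≺c⁀u = α≺α+β (len c) (len u) (≺α⇒≺α+β (len v) (len (⟦ r ⟧ʷ v)) (0≺len-⟨n⟩⁀ n l))
  n≡m : n ≡ m
  n≡m = begin
    n                  ≡⟨ at-⟨n⟩⁀ n l ⟨
    at v 0ᵒ            ≡⟨ at-⁀ˡ v (⟦ r ⟧ʷ v) (0≺len-⟨n⟩⁀ n l) ⟨
    at u 0ᵒ            ≡⟨ at-len-⁀ c u ⟨
    at (c ⁀ u) (len c) ≡⟨ ≈⇒at≡ eq c≺c⁀u ⟩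
    at (s v) (len c)   ≡⟨ pinned v ⟩
    m                  ∎

SettledAbove : ℕ → Word → Word → Set
SettledAbove N w w' = ∀ {n} → N ≤ n → ∀ l →
  ⟦ w ⟧ʷ (⟨ n ⟩ ⁀ l) ≈ ⟦ w' ⟧ʷ (⟨ n ⟩ ⁀ l) → ∀ v → ⟦ w ⟧ʷ v ≈ ⟦ w' ⟧ʷ v

word-equation-settled : ∀ w w' → ∃ λ N → SettledAbove N w w'
word-equation-settled (const d) (const d') = 0 , λ _ _ d≈d' _ → d≈d'
word-equation-settled (const d) (c ·X· r) = suc (at d (len c)) , λ N≤n l eq →
  contradiction (≈-sym eq) (X-pinned c r (λ _ → d) (λ _ → refl) N≤n l)
word-equation-settled (c ·X· r) (const d) = suc (at d (len c)) , λ N≤n l eq →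
  contradiction eq (X-pinned c r (λ _ → d) (λ _ → refl) N≤n l)
word-equation-settled (c ·X· r) (d ·X· r') with ≺-cmp (len c) (len d)
... | tri< c≺d _ _ = suc (at d (len c)) , λ N≤n l eq →
  contradiction eq (X-pinned c r ⟦ d ·X· r' ⟧ʷ (λ v → at-⁀ˡ d (v ⁀ ⟦ r' ⟧ʷ v) c≺d) N≤n l)
... | tri> _ _ d≺c = suc (at c (len d)) , λ N≤n l eq →
  contradiction (≈-sym eq) (X-pinned d r' ⟦ c ·X· r ⟧ʷ (λ v → at-⁀ˡ c (v ⁀ ⟦ r ⟧ʷ v) d≺c) N≤n l)
... | tri≈ _ c≡d _ with N , settled-r ← word-equation-settled r r' = N , λ {n} N≤n l eq v →
  let V = ⟨ n ⟩ ⁀ l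
      c≈d , Xr≈Xr' = ⁀-injective c d (V ⁀ ⟦ r ⟧ʷ V) (V ⁀ ⟦ r' ⟧ʷ V) c≡d eq
      _ , r≈r' = ⁀-injective V V (⟦ r ⟧ʷ V) (⟦ r' ⟧ʷ V) refl Xr≈Xr'
  in ⁀-cong c≈d (⁀-cong (≈-refl {v}) (settled-r N≤n l r≈r' v))

lemma4p12 : (E : Equation) →
    Σ 𝔏 (λ l → ¬ Holds E (proj₁ l)) →
    Σ ℕ λ N → (n : ℕ) → N ≤ n → (l : 𝔏) → ¬ Holds E (⟨ n ⟩ ⁀ proj₁ l)
lemma4p12 (_≐_ {i} (cᵢ a) (cᵢ b)) (_ , a≢b) = 0 , λ _ _ _ → a≢b
lemma4p12 (_≐_ {list} t u) ((l₀ , _) , fails) with N , settled ← word-equation-settled (word t) (word u) =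
  N , λ n N≤n (l , _) holds →
    fails (Equivalence.from (word-equation t u l₀)
      (settled N≤n l (Equivalence.to (word-equation t u (⟨ n ⟩ ⁀ l)) holds) l₀))
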